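{- Let $(\mathcal{A},\lambda,L)$ and $(\mathcal{A}',\lambda',L)$ be $Pom_L$-bisimilar labelled asynchronous systems, $\mathcal{A}=(S,s_0,E,I,\mathrm{Tran})$, $\mathcal{A}'=(S',s'_0,E',I',\mathrm{Tran}')$. For each word $w=a_1\cdots a_k\in E^*$, $k\ge 0$, with $s_0\cdot w\in S$, there is a word $w'=a'_1\cdots a'_k\in E'^*$ such that $s'_0\cdot w'\in S'$ and $H_n(\mathcal{A}(s_0\cdot w),\lambda,L)\cong H_n(\mathcal{A}'(s'_0\cdot w'),\lambda',L)$ for all $n\ge 0$.
   Context: A state space $(S,E,I,\mathrm{Tran})$: states $S$, events $E$, symmetric irreflexive independence $I\subseteq E\times E$, transitions $\mathrm{Tran}\subseteq S\times E\times S$, with (1) $(s,a,s'),(s,a,s'')\in\mathrm{Tran}\Rightarrow s'=s''$; (2) if $(a,b)\in I$, $(s,a,s'),(s',b,s'')\in\mathrm{Tran}$ then some $s_1$ has $(s,b,s_1),(s_1,a,s'')\in\mathrm{Tran}$. An asynchronous system $\mathcal{A}=(S,s_0,E,I,\mathrm{Tran})$ adds an initial state $s_0$, every event occurring in some transition. $E^*$ is the set of words over $E$. For a word $w=e_1\cdots e_k$, $s\cdot w\in S$ means there are $s=t_0,\dots,t_k$ with $(t_{i-1},e_i,t_i)\in\mathrm{Tran}$, and $s\cdot w=t_k$. A state is reachable if it is $s_0\cdot w$ for some word $w$ (possibly empty). For reachable $s$, $\mathcal{A}(s)=(S,s,E,I,\mathrm{Tran})$; its reachable states are those of the form $s\cdot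 w$. A morphism $(\sigma,\eta):\mathcal{A}\to\mathcal{A}'$: total $\sigma:S\to S'$ with $\sigma(s_0)=s'_0$, partial $\eta:E\rightharpoonup E'$, such that for each $(s_1,e,s_2)\in\mathrm{Tran}$, $(\sigma(s_1),\eta(e),\sigma(s_2))\in\mathrm{Tran}'$ if $\eta(e)$ is defined and $\sigma(s_1)=\sigma(s_2)$ otherwise, and $(\eta(e_1),\eta(e_2))\in I'$ for $(e_1,e_2)\in I$ with both defined. It is open if (a) $\eta$ is total; (b) for every $s\in S$ and $(\sigma(s),e',u')\in\mathrm{Tran}'$ there is $(s,e,u)\in\mathrm{Tran}$ with $\eta(e)=e'$, $\sigma(u)=u'$; (c) for every reachable $s$, if $(s,e_1,u),(u,e_2,v)\in\mathrm{Tran}$ and $(\eta(e_1),\eta(e_2))\in I'$ then $(e_1,e_2)\in I$. A labelled asynchronous system $(\mathcal{A},\lambda,L)$ has a label map $\lambda:E\to L$. A $Pom_L$-open morphism is an open morphism with $\lambda(e)=\lambda'(\eta(e))$ for all $e$. Two labelled asynchronous systems are $Pom_L$-bisimilar if some labelled asynchronous system (same $L$) has $Pom_L$-open morphisms to both. Homology: for a labelled asynchronous system $(\mathcal{B},\mu,L)$ with initial state $b_0$, form the simplicial scheme with vertices $\mu(a)$ for events $a$ such that $b\cdot a$ is defined for some reachable (from $b_0$) state $b$, and simplices the finite sets $\{\mu(a_1),\dots,\mu(a_k)\}$, $k\ge1$ (repetitions removed), with $a_i,a_j$ independent for all $i<j$ and $b\cdot a_1\cdots a_k$ defined for some reachable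 $b$. $H_n(\mathcal{B},\mu,L)$ is the $n$th integral simplicial homology of this scheme. -}

module Defs where

open import Data.Nat using (ℕ; zero; suc)
open import Data.Fin as Fin using (Fin; toℕ; punchIn)
open import Data.Fin.Permutation.Components using (transpose)
open import Data.Integer as ℤ using (ℤ; 0ℤ; 1ℤ; -_)
open import Data.List using (List; []; _∷_; _++_; map; concatMap; allFin)
open import Data.Vec.Functional using (toList)
open import Data.Maybe using (Maybe; just; nothing)
open import Data.Product using (Σ; ∃; _×_; _,_; proj₁; proj₂)
open import Data.Unit using (⊤)
open import Function using (_∘_)
open import Relation.Nullary using (¬_)
open import Relation.Binary.PropositionalEquality using (_≡_; _≢_)

record AsyncSystem : Set₁ where
  field
    S    : Set
    s₀   : S
    E    : Set
    I    : E → E → Set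
    Tran : S → E → S → Set
    I-sym   : ∀ {a b} → I a b → I b a
    I-irr   : ∀ {a} → ¬ I a a
    det     : ∀ {s a s′ s″} → Tran s a s′ → Tran s a s″ → s′ ≡ s″
    diamond : ∀ {a b s s′ s″} → I a b → Tran s a s′ → Tran s′ b s″ →
              ∃ λ s₁ → Tran s b s₁ × Tran s₁ a s″
    occurs  : ∀ e → ∃ λ s → ∃ λ s′ → Tran s e s′

module _ (A : AsyncSystem) where
  open AsyncSystem A

  -- Run s w t  means  s · w  is defined and equals t
  data Run : S → List E → S → Set where
    []  : ∀ {s} → Run s [] s
    _∷_ : ∀ {s e u w t} → Tran s e u → Run u w t → Run s (e ∷ w) t

  ReachableFrom : S → S → Set
  ReachableFrom s t = ∃ λ w → Run s w t

  Reachable : S → Set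
  Reachable = ReachableFrom s₀

record Morphism (A A′ : AsyncSystem) : Set where
  module A = AsyncSystem A
  module A′ = AsyncSystem A′
  field
    σ  : A.S → A′.S
    σ₀ : σ A.s₀ ≡ A′.s₀
    η  : A.E → Maybe A′.E
    tran-def   : ∀ {s₁ e s₂ e′} → A.Tran s₁ e s₂ → η e ≡ just e′ →
                 A′.Tran (σ s₁) e′ (σ s₂)
    tran-undef : ∀ {s₁ e s₂} → A.Tran s₁ e s₂ → η e ≡ nothing → σ s₁ ≡ σ s₂
    indep      : ∀ {e₁ e₂ e₁′ e₂′} → A.I e₁ e₂ → η e₁ ≡ just e₁′ →
                 η e₂ ≡ just e₂′ → A′.I e₁′ e₂′

record IsOpen {A A′ : AsyncSystem} (m : Morphism A A′) : Set where
  open Morphism m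
  field
    total : ∀ e → ∃ λ e′ → η e ≡ just e′
    lift  : ∀ s e′ u′ → A′.Tran (σ s) e′ u′ →
            ∃ λ e → ∃ λ u → A.Tran s e u × η e ≡ just e′ × σ u ≡ u′
    reflect-I : ∀ s → Reachable A s → ∀ {e₁ e₂ u v e₁′ e₂′} →
                A.Tran s e₁ u → A.Tran u e₂ v → η e₁ ≡ just e₁′ →
                η e₂ ≡ just e₂′ → A′.I e₁′ e₂′ → A.I e₁ e₂

record LAS (L : Set) : Set₁ where
  field
    sys : AsyncSystem
    lab : AsyncSystem.E sys → L

record PomOpen {L : Set} (B B′ : LAS L) : Set where
  module B = LAS B
  module B′ = LAS B′
  field
    mor     : Morphism B.sys B′.sys
    open?   : IsOpen mor
    lab-pres : ∀ e e′ → Morphism.η mor e ≡ just e′ → B.lab e ≡ B′.lab e′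

PomBisimilar : {L : Set} → LAS L → LAS L → Set₁
PomBisimilar {L} B B′ = Σ (LAS L) λ C → PomOpen C B × PomOpen C B′

-- Integral simplicial homology of a simplicial scheme on vertex type L,
-- given by a predicate Spx on finite families of vertices ("the set of
-- entries of t is a simplex"), closed under reindexing.
-- Oriented chains: free abelian group on ordered tuples spanning a
-- simplex, modulo t ∘ (transposition) = - t and degenerate tuples = 0.

sgn : ℕ → ℤ
sgn zero    = 1ℤ
sgn (suc n) = - sgn n

module Homology (L : Set) (Spx : ∀ {m} → (Fin m → L) → Set)
                (restrict : ∀ {m k} (t : Fin m → L) (f : Fin k → Fin m) →
                            Spx t → Spx (t ∘ f)) where

  Gen : ℕ → Set
  Gen n = Σ (Fin (suc n) → L) Spx

  Chain : ℕ → Set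
  Chain n = List (ℤ × Gen n)

  neg : ∀ {n} → Chain n → Chain n
  neg = map (λ p → (- proj₁ p , proj₂ p))

  data _≈_ {n : ℕ} : Chain n → Chain n → Set where
    ≈-refl  : ∀ {c} → c ≈ c
    ≈-sym   : ∀ {c d} → c ≈ d → d ≈ c
    ≈-trans : ∀ {c d e} → c ≈ d → d ≈ e → c ≈ e
    ≈-++    : ∀ {c c′ d d′} → c ≈ c′ → d ≈ d′ → (c ++ d) ≈ (c′ ++ d′)
    ≈-swap  : ∀ x y → (x ∷ y ∷ []) ≈ (y ∷ x ∷ [])
    ≈-merge : ∀ a b c (t t′ : Fin (suc n) → L) p p′ → c ≡ a ℤ.+ b →
              (∀ i → t i ≡ t′ i) →
              ((a , t , p) ∷ (b , t′ , p′) ∷ []) ≈ ((c , t , p) ∷ [])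
    ≈-zero  : ∀ g → ((0ℤ , g) ∷ []) ≈ []
    ≈-alt   : ∀ a (t t′ : Fin (suc n) → L) p p′ (i j : Fin (suc n)) → i ≢ j →
              (∀ x → t′ x ≡ t (transpose i j x)) →
              ((a , t , p) ∷ []) ≈ ((- a , t′ , p′) ∷ [])
    ≈-degen : ∀ a (t : Fin (suc n) → L) p (i j : Fin (suc n)) → i ≢ j →
              t i ≡ t j → ((a , t , p) ∷ []) ≈ []

  ∂ : ∀ {n} → Chain (suc n) → Chain n
  ∂ {n} = concatMap λ { (a , t , p) →
            map (λ i → (sgn (toℕ i) ℤ.* a , t ∘ punchIn i , restrict t (punchIn i) p))
                (allFin (suc (suc n))) }

  IsCycle : ∀ n → Chain n → Set
  IsCycle zero    c = ⊤
  IsCycle (suc n) c = ∂ c ≈ []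

  Cycle : ℕ → Set
  Cycle n = Σ (Chain n) (IsCycle n)

  Homologous : ∀ {n} → Chain n → Chain n → Set
  Homologous {n} c c′ = ∃ λ (b : Chain (suc n)) → ∂ b ≈ (c ++ neg c′)

record HomologyIso {L : Set}
    (Spx₁ : ∀ {m} → (Fin m → L) → Set)
    (r₁ : ∀ {m k} (t : Fin m → L) (f : Fin k → Fin m) → Spx₁ t → Spx₁ (t ∘ f))
    (Spx₂ : ∀ {m} → (Fin m → L) → Set)
    (r₂ : ∀ {m k} (t : Fin m → L) (f : Fin k → Fin m) → Spx₂ t → Spx₂ (t ∘ f))
    (n : ℕ) : Set where
  module H₁ = Homology L Spx₁ r₁
  module H₂ = Homology L Spx₂ r₂
  field
    to   : H₁.Cycle n → H₂.Cycle n
    from : H₂.Cycle n → H₁.Cycle n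
    to-cong   : ∀ z w → H₁.Homologous (proj₁ z) (proj₁ w) →
                H₂.Homologous (proj₁ (to z)) (proj₁ (to w))
    from-cong : ∀ z w → H₂.Homologous (proj₁ z) (proj₁ w) →
                H₁.Homologous (proj₁ (from z)) (proj₁ (from w))
    to-hom : ∀ z w v → proj₁ v H₁.≈ (proj₁ z ++ proj₁ w) →
             H₂.Homologous (proj₁ (to v)) (proj₁ (to z) ++ proj₁ (to w))
    from∘to : ∀ z → H₁.Homologous (proj₁ (from (to z))) (proj₁ z)
    to∘from : ∀ z → H₂.Homologous (proj₁ (to (from z))) (proj₁ z)

module _ {L : Set} (B : LAS L) where
  open LAS B
  open AsyncSystem sys

  SpxAt : S → ∀ {m} → (Fin m → L) → Set
  SpxAt s {m} t =
    ∃ λ k → ∃ λ (a : Fin k → E) →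
      (∀ i j → i Fin.< j → I (a i) (a j)) ×
      (∃ λ b → ReachableFrom sys s b × ∃ λ v → Run sys b (toList a) v) ×
      (∀ x → ∃ λ j → t x ≡ lab (a j))

  SpxAt-restrict : ∀ s {m k} (t : Fin m → L) (f : Fin k → Fin m) →
                   SpxAt s t → SpxAt s (t ∘ f)
  SpxAt-restrict s t f (k , a , ind , ex , cov) = k , a , ind , ex , λ x → cov (f x)

HnIso : {L : Set} (B : LAS L) (s : AsyncSystem.S (LAS.sys B))
        (B′ : LAS L) (s′ : AsyncSystem.S (LAS.sys B′)) → ℕ → Set
HnIso B s B′ s′ n =
  HomologyIso (SpxAt B s) (SpxAt-restrict B s) (SpxAt B′ s′) (SpxAt-restrict B′ s′) n

-- Lift the run s₀·w to the common cover C of the bisimulation, reaching c, and set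
-- t′ := σ′(c); then t = σ(c). An open morphism σ pushes simplices at c forward to σ(c)
-- and pulls them back along lifted runs: the lifted letters are pairwise independent
-- because any later letter can be commuted, by the diamond property, to sit directly
-- after an earlier one, where open morphisms reflect independence. So t and t′ carry
-- the same simplicial scheme, and the identity on oriented chains induces the
-- isomorphism of homology.

module Submission where

open import Data.Fin as Fin using (Fin; toℕ; punchIn)
open import Data.Integer as ℤ using (ℤ; 0ℤ)
open import Data.Integer.Properties using (+-inverseʳ; +-identityˡ)
open import Data.List using (List; []; _∷_; _++_; _∷ʳ_; map; allFin; length; tabulate; lookup)
open import Data.List.Properties
  using (map-++; ++-assoc; map-∘; ∷-injective; length-map; map-tabulate; tabulate-cong; tabulate-lookup; length-tabulate)
open import Data.List.Relation.Unary.All as All using (All; []; _∷_)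
import Data.List.Relation.Unary.All.Properties as All
open import Data.List.Relation.Unary.AllPairs using (AllPairs; []; _∷_)
import Data.List.Relation.Unary.AllPairs.Properties as AllPairs
open import Data.Maybe using (just)
open import Data.Maybe.Properties using (just-injective)
open import Data.Nat using (ℕ; zero; suc; s≤s)
open import Data.Product using (∃; _×_; _,_; proj₁; proj₂)
open import Function using (_∘_; _on_; _⇔_; mk⇔; Equivalence)
open import Function.Construct.Composition using (_⇔-∘_)
open import Function.Construct.Symmetry using (⇔-sym)
open import Relation.Binary.Bundles using (Setoid)
import Relation.Binary.Reasoning.Setoid as SetoidReasoning
open import Relation.Binary.PropositionalEquality
open import Defs

module _ {L : Set} where

  Scheme : Set₁
  Scheme = ∀ {m} → (Fin m → L) → Set

  ClosedUnderRestriction : Scheme → Set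
  ClosedUnderRestriction Spx = ∀ {m k} (t : Fin m → L) (f : Fin k → Fin m) → Spx t → Spx (t ∘ f)

module ChainGroup {L : Set} (Spx : Scheme {L}) (r : ClosedUnderRestriction Spx) where
  open Homology L Spx r

  erase : ∀ {n} → ℤ × Gen n → ℤ × (Fin (suc n) → L)
  erase (a , t , _) = a , t

  chainSetoid : ℕ → Setoid _ _
  chainSetoid n = record
    { Carrier = Chain n ; _≈_ = _≈_
    ; isEquivalence = record { refl = ≈-refl ; sym = ≈-sym ; trans = ≈-trans } }

  ≈-∷ : ∀ {n} x {c d : Chain n} → c ≈ d → (x ∷ c) ≈ (x ∷ d)
  ≈-∷ x = ≈-++ {c = x ∷ []} ≈-refl

  -- Exchange the witness by merging with the zero chain (0, t, p′).
  ≈-witness : ∀ {n} a (t : Fin (suc n) → L) p p′ → ((a , t , p) ∷ []) ≈ ((a , t , p′) ∷ [])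
  ≈-witness a t p p′ =
    ≈-trans (≈-sym (≈-++ {c = (0ℤ , t , p′) ∷ []} (≈-zero _) ≈-refl))
            (≈-merge 0ℤ a a t t p′ p (sym (+-identityˡ a)) (λ _ → refl))

  ≈-erase : ∀ {n} {c d : Chain n} → map erase c ≡ map erase d → c ≈ d
  ≈-erase {c = []} {d = []} _ = ≈-refl
  ≈-erase {c = (a , t , p) ∷ c} {d = (_ , _ , p′) ∷ d} eq with ∷-injective eq
  ... | refl , eq′ = ≈-++ (≈-witness a t p p′) (≈-erase eq′)

  ∷≈∷ʳ : ∀ {n} x (d : Chain n) → (x ∷ d) ≈ (d ∷ʳ x)
  ∷≈∷ʳ x []      = ≈-refl
  ∷≈∷ʳ x (y ∷ d) = ≈-trans (≈-++ {d = d} (≈-swap x y) ≈-refl) (≈-∷ y (∷≈∷ʳ x d))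

  ++-neg≈[] : ∀ {n} (c : Chain n) → (c ++ neg c) ≈ []
  ++-neg≈[] []      = ≈-refl
  ++-neg≈[] (x@(a , t , p) ∷ c) = begin
    x ∷ c ++ x̄ ∷ neg c    ≡⟨ cong (x ∷_) (++-assoc c (x̄ ∷ []) (neg c)) ⟨
    x ∷ (c ∷ʳ x̄) ++ neg c ≈⟨ ≈-∷ x (≈-++ (∷≈∷ʳ x̄ c) ≈-refl) ⟨
    x ∷ x̄ ∷ c ++ neg c    ≈⟨ ≈-++ {c = x ∷ x̄ ∷ []} x+x̄≈[] (++-neg≈[] c) ⟩
    []                    ∎
    where
    open SetoidReasoning (chainSetoid _)
    x̄ = (ℤ.- a , t , p)
    x+x̄≈[] : (x ∷ x̄ ∷ []) ≈ []
    x+x̄≈[] = ≈-trans (≈-merge a (ℤ.- a) 0ℤ t t p p (sym (+-inverseʳ a)) (λ _ → refl)) (≈-zero _)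

  ≈⇒Homologous : ∀ {n} {c d : Chain n} → c ≈ d → Homologous c d
  ≈⇒Homologous {d = d} c≈d = [] , ≈-sym (≈-trans (≈-++ c≈d ≈-refl) (++-neg≈[] d))

module Transport {L : Set}
  (Spx₁ : Scheme {L}) (r₁ : ClosedUnderRestriction Spx₁)
  (Spx₂ : Scheme {L}) (r₂ : ClosedUnderRestriction Spx₂)
  (F : ∀ {m} (t : Fin m → L) → Spx₁ t → Spx₂ t) where
  module H₁ = Homology L Spx₁ r₁
  module H₂ = Homology L Spx₂ r₂
  module G₁ = ChainGroup Spx₁ r₁
  module G₂ = ChainGroup Spx₂ r₂

  transport : ∀ {n} → H₁.Chain n → H₂.Chain n
  transport = map λ { (a , t , p) → a , t , F t p }

  transport-++ : ∀ {n} (c d : H₁.Chain n) → transport (c ++ d) ≡ transport c ++ transport d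
  transport-++ = map-++ _

  transport-neg : ∀ {n} (c : H₁.Chain n) → transport (H₁.neg c) ≡ H₂.neg (transport c)
  transport-neg c = trans (sym (map-∘ c)) (map-∘ c)

  erase-transport : ∀ {n} (c : H₁.Chain n) → map G₂.erase (transport c) ≡ map G₁.erase c
  erase-transport c = sym (map-∘ c)

  transport-≈ : ∀ {n} {c d : H₁.Chain n} → c H₁.≈ d → transport c H₂.≈ transport d
  transport-≈ H₁.≈-refl            = H₂.≈-refl
  transport-≈ (H₁.≈-sym p)         = H₂.≈-sym (transport-≈ p)
  transport-≈ (H₁.≈-trans p q)     = H₂.≈-trans (transport-≈ p) (transport-≈ q)
  transport-≈ (H₁.≈-++ {c} {c′} {d} {d′} p q) =
    subst₂ H₂._≈_ (sym (transport-++ c d)) (sym (transport-++ c′ d′))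
           (H₂.≈-++ (transport-≈ p) (transport-≈ q))
  transport-≈ (H₁.≈-swap x y)                  = H₂.≈-swap _ _
  transport-≈ (H₁.≈-merge a b c t t′ _ _ e f)  = H₂.≈-merge a b c t t′ _ _ e f
  transport-≈ (H₁.≈-zero g)                    = H₂.≈-zero _
  transport-≈ (H₁.≈-alt a t t′ _ _ i j i≢j f)  = H₂.≈-alt a t t′ _ _ i j i≢j f
  transport-≈ (H₁.≈-degen a t _ i j i≢j e)     = H₂.≈-degen a t _ i j i≢j e

  erase-∂-transport : ∀ {n} (c : H₁.Chain (suc n)) →
                      map G₂.erase (H₂.∂ (transport c)) ≡ map G₁.erase (H₁.∂ c)
  erase-∂-transport []      = refl
  erase-∂-transport {n} ((a , t , p) ∷ c) =
    trans (map-++ G₂.erase faces₂ (H₂.∂ (transport c)))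
      (trans (cong₂ _++_ (trans (sym (map-∘ is)) (map-∘ is)) (erase-∂-transport c))
             (sym (map-++ G₁.erase faces₁ (H₁.∂ c))))
    where
    is = allFin (suc (suc n))
    faces₁ = map (λ i → sgn (toℕ i) ℤ.* a , t ∘ punchIn i , r₁ t (punchIn i) p) is
    faces₂ = map (λ i → sgn (toℕ i) ℤ.* a , t ∘ punchIn i , r₂ t (punchIn i) (F t p)) is

  ∂-transport : ∀ {n} (c : H₁.Chain (suc n)) → H₂.∂ (transport c) H₂.≈ transport (H₁.∂ c)
  ∂-transport c = G₂.≈-erase (trans (erase-∂-transport c) (sym (erase-transport (H₁.∂ c))))

  transport-IsCycle : ∀ n {c} → H₁.IsCycle n c → H₂.IsCycle n (transport c)
  transport-IsCycle zero    _           = _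
  transport-IsCycle (suc n) {c} ∂c≈[] = H₂.≈-trans (∂-transport c) (transport-≈ ∂c≈[])

  transport-cycle : ∀ n → H₁.Cycle n → H₂.Cycle n
  transport-cycle n (c , c-cycle) = transport c , transport-IsCycle n c-cycle

  transport-Homologous : ∀ {n} (c d : H₁.Chain n) → H₁.Homologous c d →
                         H₂.Homologous (transport c) (transport d)
  transport-Homologous c d (b , ∂b≈c-d) =
    transport b ,
    H₂.≈-trans (∂-transport b)
      (subst (transport (H₁.∂ b) H₂.≈_)
             (trans (transport-++ c (H₁.neg d)) (cong (transport c ++_) (transport-neg d)))
             (transport-≈ ∂b≈c-d))

  transport-additive : ∀ {n} (c d v : H₁.Chain n) → v H₁.≈ (c ++ d) →
                       H₂.Homologous (transport v) (transport c ++ transport d)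
  transport-additive c d _ v≈c+d =
    G₂.≈⇒Homologous (subst (_ H₂.≈_) (transport-++ c d) (transport-≈ v≈c+d))

homologyIso-⇔ : {L : Set}
  (Spx₁ : Scheme {L}) (r₁ : ClosedUnderRestriction Spx₁)
  (Spx₂ : Scheme {L}) (r₂ : ClosedUnderRestriction Spx₂) →
  (∀ {m} (t : Fin m → L) → Spx₁ t ⇔ Spx₂ t) → ∀ n → HomologyIso Spx₁ r₁ Spx₂ r₂ n
homologyIso-⇔ Spx₁ r₁ Spx₂ r₂ Spx₁⇔Spx₂ n = record
  { to        = T.transport-cycle n
  ; from      = T⁻.transport-cycle n
  ; to-cong   = λ z w → T.transport-Homologous (proj₁ z) (proj₁ w)
  ; from-cong = λ z w → T⁻.transport-Homologous (proj₁ z) (proj₁ w)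
  ; to-hom    = λ z w v → T.transport-additive (proj₁ z) (proj₁ w) (proj₁ v)
  ; from∘to   = λ z → G₁.≈⇒Homologous (T⁻∘T≈id (proj₁ z))
  ; to∘from   = λ z → G₂.≈⇒Homologous (T∘T⁻≈id (proj₁ z))
  }
  where
  module T  = Transport Spx₁ r₁ Spx₂ r₂ (λ t → Equivalence.to (Spx₁⇔Spx₂ t))
  module T⁻ = Transport Spx₂ r₂ Spx₁ r₁ (λ t → Equivalence.from (Spx₁⇔Spx₂ t))
  module G₁ = ChainGroup Spx₁ r₁
  module G₂ = ChainGroup Spx₂ r₂

  T⁻∘T≈id : ∀ {k} (c : T.H₁.Chain k) → T⁻.transport (T.transport c) T.H₁.≈ c
  T⁻∘T≈id c = G₁.≈-erase (trans (T⁻.erase-transport (T.transport c)) (T.erase-transport c))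

  T∘T⁻≈id : ∀ {k} (c : T.H₂.Chain k) → T.transport (T⁻.transport c) T.H₂.≈ c
  T∘T⁻≈id c = G₂.≈-erase (trans (T.erase-transport (T⁻.transport c)) (T⁻.erase-transport c))

tabulate⁻-< : ∀ {A : Set} {R : A → A → Set} {k} (a : Fin k → A) →
              AllPairs R (tabulate a) → ∀ i j → i Fin.< j → R (a i) (a j)
tabulate⁻-< a (Ra₀ ∷ _) Fin.zero    (Fin.suc j) _           = All.tabulate⁻ Ra₀ j
tabulate⁻-< a (_ ∷ Ra₊) (Fin.suc i) (Fin.suc j) (s≤s i<j) = tabulate⁻-< (a ∘ Fin.suc) Ra₊ i j i<j

module _ (A : AsyncSystem) where
  open AsyncSystem A

  run-++ : ∀ {s u v xs ys} → Run A s xs u → Run A u ys v → Run A s (xs ++ ys) v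
  run-++ []      r = r
  run-++ (x ∷ q) r = x ∷ run-++ q r

  reachable-run : ∀ {s w t} → Reachable A s → Run A s w t → Reachable A t
  reachable-run (w₀ , r₀) r = w₀ ++ _ , run-++ r₀ r

  reachable-tran : ∀ {s e t} → Reachable A s → Tran s e t → Reachable A t
  reachable-tran rs tr = reachable-run rs (tr ∷ [])

module OpenMorphism {A A′ : AsyncSystem} (m : Morphism A A′) (m-open : IsOpen m) where
  open Morphism m public hiding (module A; module A′)
  open IsOpen m-open
  module A  = AsyncSystem A
  module A′ = AsyncSystem A′

  h : A.E → A′.E
  h e = proj₁ (total e)

  η≡just-h : ∀ e → η e ≡ just (h e)
  η≡just-h e = proj₂ (total e)

  tran-h : ∀ {s e u} → A.Tran s e u → A′.Tran (σ s) (h e) (σ u)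
  tran-h tr = tran-def tr (η≡just-h _)

  run-h : ∀ {s w t} → Run A s w t → Run A′ (σ s) (map h w) (σ t)
  run-h []       = []
  run-h (tr ∷ r) = tran-h tr ∷ run-h r

  lift-tran : ∀ s {s′ e′ u′} → σ s ≡ s′ → A′.Tran s′ e′ u′ →
              ∃ λ e → ∃ λ u → A.Tran s e u × h e ≡ e′ × σ u ≡ u′
  lift-tran s refl tr′ with lift s _ _ tr′
  ... | e , u , tr , ηe≡e′ , σu≡u′ =
    e , u , tr , just-injective (trans (sym (η≡just-h e)) ηe≡e′) , σu≡u′

  lift-tabulated-run : ∀ {k} s {s′ t′} (a′ : Fin k → A′.E) → σ s ≡ s′ →
    Run A′ s′ (tabulate a′) t′ →
    ∃ λ (a : Fin k → A.E) → (∀ i → h (a i) ≡ a′ i) × ∃ λ t → Run A s (tabulate a) t × σ t ≡ t′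
  lift-tabulated-run {zero}  s a′ σs≡s′ []         = (λ ()) , (λ ()) , s , [] , σs≡s′
  lift-tabulated-run {suc k} s a′ σs≡s′ (tr′ ∷ r′) with lift-tran s σs≡s′ tr′
  ... | e , u , tr , he≡ , σu≡ with lift-tabulated-run u (a′ ∘ Fin.suc) σu≡ r′
  ... | a , ha≡ , t , r , σt≡ =
    (λ { Fin.zero → e ; (Fin.suc i) → a i }) , (λ { Fin.zero → he≡ ; (Fin.suc i) → ha≡ i }) ,
    t , tr ∷ r , σt≡

  lift-run : ∀ s {s′ w′ t′} → σ s ≡ s′ → Run A′ s′ w′ t′ →
             ∃ λ w → length w ≡ length w′ × ∃ λ t → Run A s w t × σ t ≡ t′
  lift-run s {w′ = w′} σs≡s′ r′
    with lift-tabulated-run s (lookup w′) σs≡s′ (subst (λ v → Run A′ _ v _) (sym (tabulate-lookup w′)) r′)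
  ... | a , _ , t , r , σt≡ = tabulate a , length-tabulate a , t , r , σt≡

  Iₕ : A.E → A.E → Set
  Iₕ = A′.I on h

  reflect-Iₕ : ∀ {s e₁ e₂ u v} → Reachable A s → A.Tran s e₁ u → A.Tran u e₂ v → Iₕ e₁ e₂ → A.I e₁ e₂
  reflect-Iₕ {s} rs tr₁ tr₂ = reflect-I s rs tr₁ tr₂ (η≡just-h _) (η≡just-h _)

  fire-first : ∀ {s zs u y v} → Reachable A s → Run A s zs u → A.Tran u y v →
               All (λ z → Iₕ z y) zs → ∃ λ s′ → A.Tran s y s′ × Run A s′ zs v
  fire-first rs []        tr []        = _ , tr , []
  fire-first rs (tz ∷ r)  tr (Iₕzy ∷ Iₕzsy) with fire-first (reachable-tran A rs tz) r tr Iₕzsy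
  ... | _ , ty , r′ with A.diamond (reflect-Iₕ rs tz ty Iₕzy) tz ty
  ... | s′ , ty′ , tz′ = s′ , ty′ , tz′ ∷ r′

  -- zs is the stretch of the run between x and the next letter y; since y is
  -- Iₕ-independent of all of zs it can be fired right after x.
  independent-of-later : ∀ {s x s₁ zs u} es {v} → Reachable A s → A.Tran s x s₁ → Run A s₁ zs u →
    Run A u es v → All (Iₕ x) es → All (λ e → All (λ z → Iₕ z e) zs) es → AllPairs Iₕ es →
    All (A.I x) es
  independent-of-later []       rs tx rz []        _ _ _ = []
  independent-of-later (y ∷ es) rs tx rz (ty ∷ r) (Iₕxy ∷ Iₕxes) (Iₕzsy ∷ Iₕzses) (Iₕyes ∷ Iₕes)
    with fire-first (reachable-tran A rs tx) rz ty Iₕzsy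
  ... | _ , ty′ , _ =
    reflect-Iₕ rs tx ty′ Iₕxy ∷
    independent-of-later es rs tx (run-++ A rz (ty ∷ [])) r Iₕxes
      (All.zipWith (λ (Iₕzse , Iₕye) → All.++⁺ Iₕzse (Iₕye ∷ [])) (Iₕzses , Iₕyes)) Iₕes

  reflect-AllPairs-Iₕ : ∀ {s es v} → Reachable A s → Run A s es v → AllPairs Iₕ es → AllPairs A.I es
  reflect-AllPairs-Iₕ rs []         []              = []
  reflect-AllPairs-Iₕ rs (tx ∷ r) (Iₕxes ∷ Iₕes) =
    independent-of-later _ rs tx [] r Iₕxes (All.universal (λ _ → []) _) Iₕes ∷
    reflect-AllPairs-Iₕ (reachable-tran A rs tx) r Iₕes

module PomOpenMorphism {L : Set} {C B : LAS L} (P : PomOpen C B) where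
  open PomOpen P using (mor; open?; lab-pres)
  open OpenMorphism mor open? public
  open LAS C using () renaming (lab to labC)
  open LAS B using () renaming (lab to labB)

  lab-h : ∀ e → labC e ≡ labB (h e)
  lab-h e = lab-pres e (h e) (η≡just-h e)

  SpxAt-image : ∀ c {m} (τ : Fin m → L) → SpxAt C c τ → SpxAt B (σ c) τ
  SpxAt-image c τ (k , a , Ia , (b , (w , c→b) , v , b→v) , τ⊆a) =
    k , h ∘ a ,
    (λ i j i<j → indep (Ia i j i<j) (η≡just-h _) (η≡just-h _)) ,
    (σ b , (map h w , run-h c→b) , σ v ,
     subst (λ u → Run (LAS.sys B) (σ b) u (σ v)) (map-tabulate a h) (run-h b→v)) ,
    λ x → let j , τx≡ = τ⊆a x in j , trans τx≡ (lab-h (a j))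

  SpxAt-preimage : ∀ c → Reachable (LAS.sys C) c → ∀ {m} (τ : Fin m → L) →
                   SpxAt B (σ c) τ → SpxAt C c τ
  SpxAt-preimage c rc τ (k , a′ , Ia′ , (b′ , (w′ , σc→b′) , v′ , b′→v′) , τ⊆a′)
    with lift-run c refl σc→b′
  ... | w , _ , b , c→b , σb≡b′ with lift-tabulated-run b a′ σb≡b′ b′→v′
  ... | a , ha≡a′ , v , b→v , _ =
    k , a , tabulate⁻-< a (reflect-AllPairs-Iₕ (reachable-run (LAS.sys C) rc c→b) b→v Iₕa) ,
    (b , (w , c→b) , v , b→v) ,
    λ x → let j , τx≡ = τ⊆a′ x in j , trans τx≡ (trans (cong labB (sym (ha≡a′ j))) (sym (lab-h (a j))))
    where
    Iₕa : AllPairs Iₕ (tabulate a)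
    Iₕa = AllPairs.map⁻ (subst (AllPairs A′.I) (sym (trans (map-tabulate a h) (tabulate-cong ha≡a′)))
                               (AllPairs.tabulate⁺-< (Ia′ _ _)))

  SpxAt-⇔ : ∀ {c s} → Reachable (LAS.sys C) c → σ c ≡ s → ∀ {m} (τ : Fin m → L) →
            SpxAt C c τ ⇔ SpxAt B s τ
  SpxAt-⇔ {c} rc refl τ = mk⇔ (SpxAt-image c τ) (SpxAt-preimage c rc τ)

mainTheorem7 : {L : Set} (B B′ : LAS L) → PomBisimilar B B′ →
    (w : List (AsyncSystem.E (LAS.sys B))) (t : AsyncSystem.S (LAS.sys B)) →
    Run (LAS.sys B) (AsyncSystem.s₀ (LAS.sys B)) w t →
    ∃ λ (w′ : List (AsyncSystem.E (LAS.sys B′))) → length w′ ≡ length w ×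
    ∃ λ (t′ : AsyncSystem.S (LAS.sys B′)) →
    Run (LAS.sys B′) (AsyncSystem.s₀ (LAS.sys B′)) w′ t′ ×
    ((n : ℕ) → HnIso B t B′ t′ n)
mainTheorem7 B B′ (C , P , P′) w t s₀→t =
  let v , |v|≡|w| , c , s₀→c , σc≡t = M.lift-run (AsyncSystem.s₀ (LAS.sys C)) M.σ₀ s₀→t
      reachable-c = v , s₀→c
  in map M′.h v , trans (length-map M′.h v) |v|≡|w| , M′.σ c ,
     subst (λ s → Run (LAS.sys B′) s (map M′.h v) (M′.σ c)) M′.σ₀ (M′.run-h s₀→c) ,
     homologyIso-⇔ _ _ _ _ λ τ →
       M′.SpxAt-⇔ reachable-c refl τ ⇔-∘ ⇔-sym (M.SpxAt-⇔ reachable-c σc≡t τ)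
  where
  module M  = PomOpenMorphism P
  module M′ = PomOpenMorphism P′
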